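{- With the notation below, the set $\mathrm{Sh}(E,\sigma)$ of equivalence classes of elements of $S$ is a subgroup of the group $C_m=(\mathbb Z/2\mathbb Z)^m/\langle(1,\dots,1)\rangle$.
   Context: Let $K$ be a global field of characteristic $\neq2$, $\Omega_K$ its set of places, and $L$ either $K$ or a quadratic extension of $K$. Let $E$ be a commutative étale $L$-algebra with a $K$-linear involution $\sigma$ whose fixed field in $L$ is $K$. Write $E=E_1\times\cdots\times E_m$ with $\sigma(E_i)=E_i$, each $E_i$ being either a field stable under $\sigma$ or a product of two fields exchanged by $\sigma$, and let $F_i=E_i^\sigma$; assume each $E_i$ is either equal to $F_i=K$, or $F_i\times F_i$, or a quadratic field extension of $F_i$. Let $I=\{1,\dots,m\}$. For $i\in I$ let $\Sigma_i$ be the set of places $v\in\Omega_K$ such that all places of $F_i$ above $v$ split in $E_i$ if $E_i/F_i$ is a quadratic field extension, and $\Sigma_i=\Omega_K$ otherwise. Let $\Sigma(L/K)$ be the set of places of $K$ split in $L$ if $L\neq K$, and $\emptyset$ if $L=K$. For $x\in(\mathbb Z/2\mathbb Z)^m$ put $I_0(x)=\{i:x_i=0\}$, $I_1(x)=\{i:x_i=1\}$. Let $S$ be the set of $x$ with $\Sigma(L/K)\cup\bigcap_{i\in I_0(x)}\Sigma_i\cup\bigcap_{j\in I_1(x)}\Sigma_j=\Omega_K$, together with $(0,\dots,0)$ and $(1,\dots,1)$. Two elements $x,x'$ of $S$ are equivalent if $x+x'=(1,\dots,1)$ or $x=x'$; $\mathrm{Sh}(E,\sigma)$ denotes the set of equivalence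 classes, viewed as a subset of $C_m$ (with componentwise addition). -}

module Defs where

open import Level using (Level; _⊔_; suc)
open import Data.Bool using (Bool; true; false; _xor_)
open import Data.Nat using (ℕ)
open import Data.Fin using (Fin)
open import Data.Vec using (Vec; lookup; replicate; zipWith)
open import Data.Sum using (_⊎_)
open import Data.Product using (∃; _×_)
open import Relation.Binary.PropositionalEquality using (_≡_)

-- (ℤ/2ℤ)^m, with Bool as ℤ/2ℤ (false = 0, true = 1, xor = addition).
F2^ : ℕ → Set
F2^ m = Vec Bool m

infixl 6 _⊕_
_⊕_ : ∀ {m} → F2^ m → F2^ m → F2^ m
_⊕_ = zipWith _xor_

𝟘 : ∀ m → F2^ m
𝟘 m = replicate m false

𝟙 : ∀ m → F2^ m
𝟙 m = replicate m true

⊖_ : ∀ {m} → F2^ m → F2^ m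
⊖ x = x

-- The equivalence defining C_m = (ℤ/2ℤ)^m / ⟨(1,…,1)⟩ :
-- x ~ x'  iff  x = x'  or  x + x' = (1,…,1).
_~_ : ∀ {m} → F2^ m → F2^ m → Set
_~_ {m} x x' = x ≡ x' ⊎ x ⊕ x' ≡ 𝟙 m

-- Abstract data of the setting: a set Ω of places, the set Σ(L/K) ⊆ Ω,
-- and the sets Σ_i ⊆ Ω for i ∈ I = Fin m.
record PlaceData (m : ℕ) (ℓ : Level) : Set (suc ℓ) where
  field
    Ω     : Set ℓ
    ΣLK   : Ω → Set ℓ
    Σᵢ    : Fin m → Ω → Set ℓ

module _ {m : ℕ} {ℓ : Level} (D : PlaceData m ℓ) where
  open PlaceData D

  -- v ∈ ⋂_{i ∈ I_b(x)} Σ_i   (empty intersection = Ω)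
  InCap : F2^ m → Bool → Ω → Set ℓ
  InCap x b v = ∀ i → lookup x i ≡ b → Σᵢ i v

  InS : F2^ m → Set ℓ
  InS x = (∀ v → ΣLK v ⊎ InCap x false v ⊎ InCap x true v)
          ⊎ x ≡ 𝟘 m ⊎ x ≡ 𝟙 m

  -- Sh(E,σ) as a subset of C_m: the class of c lies in Sh iff c ~ x for some x ∈ S.
  InSh : F2^ m → Set ℓ
  InSh c = ∃ λ x → InS x × x ~ c

-- A subset of C_m (given by a predicate on representatives, invariant under ~)
-- is a subgroup.
record IsSubgroupCm {m : ℕ} {ℓ : Level} (P : F2^ m → Set ℓ) : Set ℓ where
  field
    respects : ∀ x y → x ~ y → P x → P y
    has-𝟘    : P (𝟘 m)
    closed-⊕ : ∀ x y → P x → P y → P (x ⊕ y)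
    closed-⊖ : ∀ x → P x → P (⊖ x)

-- The defining condition of S says that at every place v ∉ Σ(L/K) the vector x is
-- constant on the indices i with v ∉ Σ_i.  Vectors constant on a given index set form
-- a subgroup of (ℤ/2ℤ)^m containing (0,…,0) and (1,…,1), so the condition is closed
-- under addition and under adding (1,…,1).  Hence S is already a subgroup containing
-- (1,…,1), and Sh(E,σ) is its image in C_m.
module Submission where

open import Defs
open import Data.Nat using (ℕ)
open import Level using (Level)
open import Data.Bool using (true; false; _xor_; not)
open import Data.Bool.Properties using (xor-assoc; xor-same; not-injective; not-¬)
open import Data.Vec using ([]; _∷_; lookup; replicate)
open import Data.Vec.Properties using (lookup-replicate; lookup-zipWith)
open import Data.Empty using (⊥-elim)
open import Data.Sum using (_⊎_; inj₁; inj₂)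
open import Data.Product using (_,_)
open import Relation.Binary.PropositionalEquality
  using (_≡_; refl; sym; trans; cong; cong₂; subst)

xor≡not-xor⇒≡⊎≡ : ∀ a b c d → a xor b ≡ not (c xor d) → a ≡ c ⊎ b ≡ d
xor≡not-xor⇒≡⊎≡ false b false d e = inj₁ refl
xor≡not-xor⇒≡⊎≡ true  b true  d e = inj₁ refl
xor≡not-xor⇒≡⊎≡ false b true  false e = inj₂ e
xor≡not-xor⇒≡⊎≡ false b true  true  e = inj₂ e
xor≡not-xor⇒≡⊎≡ true  b false d e = inj₂ (not-injective e)

⊕-cancelˡ : ∀ {m} (x c : F2^ m) → x ⊕ (x ⊕ c) ≡ c
⊕-cancelˡ []      []      = refl
⊕-cancelˡ (a ∷ x) (b ∷ c) = cong₂ _∷_ xor-cancelˡ (⊕-cancelˡ x c)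
  where
  xor-cancelˡ : a xor (a xor b) ≡ b
  xor-cancelˡ = trans (sym (xor-assoc a a b)) (cong (_xor b) (xor-same a))

module _ {m : ℕ} {ℓ : Level} {P : F2^ m → Set ℓ} where

  ⊕-closed⇒respects-~ : P (𝟙 m) → (∀ x y → P x → P y → P (x ⊕ y)) →
                        ∀ x y → x ~ y → P x → P y
  ⊕-closed⇒respects-~ P𝟙 closed x y (inj₁ refl) Px = Px
  ⊕-closed⇒respects-~ P𝟙 closed x y (inj₂ x⊕y≡𝟙) Px =
    subst P (trans (cong (x ⊕_) (sym x⊕y≡𝟙)) (⊕-cancelˡ x y)) (closed x (𝟙 m) Px P𝟙)

  ⊕-closed⇒IsSubgroupCm : P (𝟘 m) → P (𝟙 m) → (∀ x y → P x → P y → P (x ⊕ y)) →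
                          IsSubgroupCm P
  ⊕-closed⇒IsSubgroupCm P𝟘 P𝟙 closed = record
    { respects = ⊕-closed⇒respects-~ P𝟙 closed
    ; has-𝟘    = P𝟘
    ; closed-⊖ = λ _ Px → Px
    ; closed-⊕ = closed
    }

  IsSubgroupCm-resp-⇔ : ∀ {Q : F2^ m → Set ℓ} → (∀ x → P x → Q x) → (∀ x → Q x → P x) →
                        IsSubgroupCm P → IsSubgroupCm Q
  IsSubgroupCm-resp-⇔ P⇒Q Q⇒P H = record
    { respects = λ x y x~y Qx → P⇒Q y (respects x y x~y (Q⇒P x Qx))
    ; has-𝟘    = P⇒Q _ has-𝟘
    ; closed-⊖ = λ x Qx → P⇒Q x (closed-⊖ x (Q⇒P x Qx))
    ; closed-⊕ = λ x y Qx Qy → P⇒Q _ (closed-⊕ x y (Q⇒P x Qx) (Q⇒P y Qy))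
    }
    where open IsSubgroupCm H

module _ {m : ℕ} {ℓ : Level} (D : PlaceData m ℓ) where
  open PlaceData D

  Admissible : F2^ m → Set ℓ
  Admissible x = ∀ v → ΣLK v ⊎ InCap D x false v ⊎ InCap D x true v

  InCap-⊕ : ∀ x y {bx by v} → InCap D x bx v → InCap D y by v →
            InCap D (x ⊕ y) (not (bx xor by)) v
  InCap-⊕ x y {bx} {by} x-cap y-cap i e
    with xor≡not-xor⇒≡⊎≡ (lookup x i) (lookup y i) bx by
           (trans (sym (lookup-zipWith _xor_ i x y)) e)
  ... | inj₁ xᵢ≡bx = x-cap i xᵢ≡bx
  ... | inj₂ yᵢ≡by = y-cap i yᵢ≡by

  admissible-⊕ : ∀ x y → Admissible x → Admissible y → Admissible (x ⊕ y)
  admissible-⊕ x y Ax Ay v with Ax v | Ay v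
  ... | inj₁ split | _          = inj₁ split
  ... | inj₂ _     | inj₁ split = inj₁ split
  ... | inj₂ x-cap | inj₂ y-cap = inj₂ (cap-⊕ x-cap y-cap)
    where
    fromBool : ∀ b → InCap D (x ⊕ y) b v → InCap D (x ⊕ y) false v ⊎ InCap D (x ⊕ y) true v
    fromBool false = inj₁
    fromBool true  = inj₂

    cap-⊕ : InCap D x false v ⊎ InCap D x true v → InCap D y false v ⊎ InCap D y true v →
            InCap D (x ⊕ y) false v ⊎ InCap D (x ⊕ y) true v
    cap-⊕ (inj₁ cx) (inj₁ cy) = fromBool _ (InCap-⊕ x y cx cy)
    cap-⊕ (inj₁ cx) (inj₂ cy) = fromBool _ (InCap-⊕ x y cx cy)
    cap-⊕ (inj₂ cx) (inj₁ cy) = fromBool _ (InCap-⊕ x y cx cy)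
    cap-⊕ (inj₂ cx) (inj₂ cy) = fromBool _ (InCap-⊕ x y cx cy)

  InCap-replicate : ∀ b v → InCap D (replicate m b) (not b) v
  InCap-replicate b v i e = ⊥-elim (not-¬ refl (trans (sym (lookup-replicate i b)) e))

  admissible-𝟘 : Admissible (𝟘 m)
  admissible-𝟘 v = inj₂ (inj₂ (InCap-replicate false v))

  admissible-𝟙 : Admissible (𝟙 m)
  admissible-𝟙 v = inj₂ (inj₁ (InCap-replicate true v))

  InS⇒Admissible : ∀ x → InS D x → Admissible x
  InS⇒Admissible x (inj₁ Ax)          = Ax
  InS⇒Admissible x (inj₂ (inj₁ refl)) = admissible-𝟘
  InS⇒Admissible x (inj₂ (inj₂ refl)) = admissible-𝟙

  InSh⇒Admissible : ∀ c → InSh D c → Admissible c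
  InSh⇒Admissible c (x , x∈S , x~c) =
    ⊕-closed⇒respects-~ admissible-𝟙 admissible-⊕ x c x~c (InS⇒Admissible x x∈S)

  Admissible⇒InSh : ∀ c → Admissible c → InSh D c
  Admissible⇒InSh c Ac = c , inj₁ Ac , inj₁ refl

lemma4p1p1 : ∀ {ℓ : Level} (m : ℕ) (D : PlaceData m ℓ) → IsSubgroupCm (InSh D)
lemma4p1p1 m D =
  IsSubgroupCm-resp-⇔ (Admissible⇒InSh D) (InSh⇒Admissible D)
    (⊕-closed⇒IsSubgroupCm (admissible-𝟘 D) (admissible-𝟙 D) (admissible-⊕ D))
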